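{- Let $f:\mathcal X\times\mathcal Y\to\{0,1\}$ and let $\mu$ be a product distribution on $\mathcal X\times\mathcal Y$. If $\mathrm{srec}^{0,\mu}_{\varepsilon,\delta}(f)\le D$, then for every $\rho\in(0,1)$ there exists a rectangle $S$ that is $(1-\rho)$-biased towards $0$ and satisfies $$\mu(S)\ge\mu_0(S)\ge\frac1D\left((1-\varepsilon)\mu_0-\frac\delta\rho\,\mu_1\right).$$
   Context: $\mathcal X,\mathcal Y$ finite nonempty sets; a rectangle is $R=A\times B$ with $A\subseteq\mathcal X$, $B\subseteq\mathcal Y$. A product distribution satisfies $\mu(x,y)=\mu_A(x)\mu_B(y)$. For a rectangle $R$ and $z\in\{0,1\}$, $\mu_z(R):=\mu(R\cap f^{ -1}(z))$ and $\mu_z:=\mu(f^{ -1}(z))$. A rectangle $R$ is $(1-\alpha)$-biased towards $0$ if $\mu_1(R)\le\alpha\,\mu_0(R)$. $\mathrm{srec}^{z,\mu}_{\varepsilon,\delta}(f)$ is the optimal value of the LP: minimize $\sum_R w_R$ over $w_R\ge0$ subject to $\sum_{(x,y)\in f^{ -1}(z)}\mu(x,y)\sum_{R\ni(x,y)}w_R\ge(1-\varepsilon)\mu_z$; $\sum_{R\ni(x,y)}w_R\le\delta$ for all $(x,y)\notin f^{ -1}(z)$; $\sum_{R\ni(x,y)}w_R\le1$ for all $(x,y)$.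
   Formalization: The product distribution μ (with its factors $\mu_A$ and $\mu_B$), the parameters ε, δ, D, ρ and the LP weights $w_R$ all take rational values. -}

module Defs where

open import Data.Bool using (Bool; true; false; if_then_else_; _∧_)
open import Data.Nat using (ℕ; zero; suc)
open import Data.Fin using (Fin)
open import Data.Vec using (Vec; []; _∷_; lookup)
open import Data.List using (List; []; _∷_; map; concatMap; foldr)
open import Data.Fin.Subset using (Subset)
open import Data.Rational using (ℚ; 0ℚ; 1ℚ; _+_; _*_; _-_; _≤_; _<_; 1/_; _>_)
open import Data.Rational.Base using (>-nonZero)
open import Data.Product using (Σ; _×_; _,_; ∃)
open import Data.Vec.Functional using () renaming (foldr to foldrF)
open import Relation.Binary.PropositionalEquality using (_≡_)

Σℚ : ∀ {k} → (Fin k → ℚ) → ℚ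
Σℚ {k} g = foldrF _+_ 0ℚ g

ΣL : ∀ {a} {A : Set a} → List A → (A → ℚ) → ℚ
ΣL xs g = foldr (λ x acc → g x + acc) 0ℚ xs

allSubsets : (k : ℕ) → List (Subset k)
allSubsets zero    = [] ∷ []
allSubsets (suc k) = concatMap (λ s → (true ∷ s) ∷ (false ∷ s) ∷ []) (allSubsets k)

-- Rectangles R = A × B with A ⊆ X = Fin m, B ⊆ Y = Fin n
Rect : ℕ → ℕ → Set
Rect m n = Subset m × Subset n

allRects : (m n : ℕ) → List (Rect m n)
allRects m n = concatMap (λ A → map (λ B → (A , B)) (allSubsets n)) (allSubsets m)

_∈R_ : ∀ {m n} → Fin m × Fin n → Rect m n → Bool
(x , y) ∈R (A , B) = lookup A x ∧ lookup B y

[_]ℚ : Bool → ℚ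
[ b ]ℚ = if b then 1ℚ else 0ℚ

IsDistribution : ∀ {k} → (Fin k → ℚ) → Set
IsDistribution p = (∀ i → 0ℚ ≤ p i) × (Σℚ p ≡ 1ℚ)

prodμ : ∀ {m n} → (Fin m → ℚ) → (Fin n → ℚ) → Fin m → Fin n → ℚ
prodμ μA μB x y = μA x * μB y

_==_ : Bool → Bool → Bool
true  == true  = true
false == false = true
_     == _     = false

module _ {m n : ℕ} (μ : Fin m → Fin n → ℚ) (f : Fin m → Fin n → Bool) where

  μR : Rect m n → ℚ
  μR R = Σℚ λ x → Σℚ λ y → [ (x , y) ∈R R ]ℚ * μ x y

  μzR : Bool → Rect m n → ℚ
  μzR z R = Σℚ λ x → Σℚ λ y → [ ((x , y) ∈R R) ∧ (f x y == z) ]ℚ * μ x y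

  μz : Bool → ℚ
  μz z = Σℚ λ x → Σℚ λ y → [ f x y == z ]ℚ * μ x y

  -- R is (1-α)-biased towards z (here used with z = 0, i.e. false): μ_{1-z}(R) ≤ α μ_z(R)
  BiasedTowards0 : ℚ → Rect m n → Set
  BiasedTowards0 α R = μzR true R ≤ α * μzR false R

  cover : (Rect m n → ℚ) → Fin m → Fin n → ℚ
  cover w x y = ΣL (allRects m n) λ R → [ (x , y) ∈R R ]ℚ * w R

  SrecFeasible : Bool → ℚ → ℚ → (Rect m n → ℚ) → Set
  SrecFeasible z ε δ w =
      (∀ R → 0ℚ ≤ w R)
    × ((1ℚ - ε) * μz z ≤ (Σℚ λ x → Σℚ λ y → [ f x y == z ]ℚ * μ x y * cover w x y))
    × (∀ x y → f x y ≡ Data.Bool.not z → cover w x y ≤ δ)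
    × (∀ x y → cover w x y ≤ 1ℚ)

  -- srec^{z,μ}_{ε,δ}(f) ≤ D : the LP (minimisation over finitely many variables)
  -- has a feasible point of value ≤ D
  SrecLE : Bool → ℚ → ℚ → ℚ → Set
  SrecLE z ε δ D = ∃ λ (w : Rect m n → ℚ) →
    SrecFeasible z ε δ w × (ΣL (allRects m n) w ≤ D)

{-# OPTIONS --safe #-}
-- Among the rectangles that are (1 - ρ)-biased towards 0 (the empty one is), let S be one of
-- largest μ₀-mass. Then every rectangle R satisfies μ₀(R) ≤ μ₀(S) + μ₁(R)/ρ: for biased R by the
-- choice of S, and otherwise because ρ μ₀(R) < μ₁(R). Averaging this against a feasible solution
-- w of the LP, after exchanging the sums over points and over rectangles, gives
--   (1 - ε) μ₀ ≤ Σ_R w_R μ₀(R) ≤ μ₀(S) Σ_R w_R + (1/ρ) Σ_R w_R μ₁(R) ≤ μ₀(S) D + (δ/ρ) μ₁.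
module Submission where

open import Defs
open import Algebra.Bundles using (CommutativeRing)
open import Data.Bool using (Bool; true; false; _∧_)
open import Data.Fin using (Fin; zero; suc)
open import Data.Fin.Subset using (⊥)
open import Data.List using (List; []; _∷_; filter)
open import Data.List.Membership.Propositional using (_∈_)
open import Data.List.Membership.Propositional.Properties using (∈-filter⁺)
open import Data.List.Relation.Unary.All as All using (All; []; _∷_)
open import Data.List.Relation.Unary.All.Properties using (all-filter)
open import Data.Nat as ℕ using (ℕ)
open import Data.Product using (_×_; _,_; ∃)
open import Data.Rational using (ℚ; 0ℚ; 1ℚ; _+_; _*_; _-_; _≤_; _<_; -_; 1/_; _÷_)
open import Data.Rational.Base using (>-nonZero; positive; nonNegative)
open import Data.Rational.Properties
open import Data.Rational.Solver using (module +-*-Solver)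
open import Data.Vec.Properties using (lookup-replicate)
open import Function using (_∘_)
open import Relation.Binary.Bundles using (DecTotalOrder)
open import Relation.Binary.PropositionalEquality
open import Relation.Nullary using (yes; no)
open import Relation.Unary using (Decidable)

-- `sum` here is definitionally Defs.Σℚ.
open import Algebra.Properties.Semiring.Sum (CommutativeRing.semiring +-*-commutativeRing)
  using (sum; ∑-distrib-+; *-distribˡ-sum; sum-cong-≗; sum-replicate-zero)
open import Data.List.Extrema (DecTotalOrder.totalOrder ≤-decTotalOrder)
  using (argmax; argmax-all; f[xs]≤f[argmax])
open +-*-Solver using (solve; _:+_; _:*_; _:-_; _:=_; con)

p≤p+q : ∀ {p q} → 0ℚ ≤ q → p ≤ p + q
p≤p+q {p} 0≤q = ≤-trans (≤-reflexive (sym (+-identityʳ p))) (+-monoʳ-≤ p 0≤q)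

p≤q+p : ∀ {p q} → 0ℚ ≤ q → p ≤ q + p
p≤q+p {p} 0≤q = ≤-trans (≤-reflexive (sym (+-identityˡ p))) (+-monoˡ-≤ p 0≤q)

*-nonNeg : ∀ {p q} → 0ℚ ≤ p → 0ℚ ≤ q → 0ℚ ≤ p * q
*-nonNeg {p} {q} 0≤p 0≤q =
  nonNegative⁻¹ (p * q) {{nonNeg*nonNeg⇒nonNeg p {{nonNegative 0≤p}} q {{nonNegative 0≤q}}}}

1/-nonNeg : ∀ {p} (p>0 : 0ℚ < p) → 0ℚ ≤ (1/ p) {{>-nonZero p>0}}
1/-nonNeg {p} p>0 = nonNegative⁻¹ p⁻¹ {{pos⇒nonNeg p⁻¹ {{1/pos⇒pos p}}}}
  where
  instance _ = positive p>0
  p⁻¹ = (1/ p) {{>-nonZero p>0}}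

ρ*p<q⇒p≤1/ρ*q : ∀ {ρ p q} (ρ>0 : 0ℚ < ρ) → ρ * p < q → p ≤ (1/ ρ) {{>-nonZero ρ>0}} * q
ρ*p<q⇒p≤1/ρ*q {ρ} {p} {q} ρ>0 ρp<q = begin
  p                  ≡⟨ *-identityˡ p ⟨
  1ℚ * p             ≡⟨ cong (_* p) (*-inverseˡ ρ) ⟨
  ρ⁻¹ * ρ * p        ≡⟨ *-assoc ρ⁻¹ ρ p ⟩
  ρ⁻¹ * (ρ * p)      ≤⟨ *-monoˡ-≤-nonNeg ρ⁻¹ {{nonNegative (1/-nonNeg ρ>0)}} (<⇒≤ ρp<q) ⟩
  ρ⁻¹ * q            ∎
  where
  open ≤-Reasoning
  instance _ = >-nonZero ρ>0
  ρ⁻¹ = 1/ ρ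

≤*+⇒1/*-≤ : ∀ {p q r d} (d>0 : 0ℚ < d) → p ≤ r * d + q → (1/ d) {{>-nonZero d>0}} * (p - q) ≤ r
≤*+⇒1/*-≤ {p} {q} {r} {d} d>0 p≤rd+q = begin
  d⁻¹ * (p - q)
    ≤⟨ *-monoˡ-≤-nonNeg d⁻¹ {{nonNegative (1/-nonNeg d>0)}} (+-monoˡ-≤ (- q) p≤rd+q) ⟩
  d⁻¹ * (r * d + q - q)
    ≡⟨ solve 4 (λ d⁻¹ r d q → d⁻¹ :* (r :* d :+ q :- q) := r :* (d :* d⁻¹)) refl d⁻¹ r d q ⟩
  r * (d * d⁻¹)
    ≡⟨ cong (r *_) (*-inverseʳ d) ⟩
  r * 1ℚ
    ≡⟨ *-identityʳ r ⟩
  r ∎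
  where
  open ≤-Reasoning
  instance _ = >-nonZero d>0
  d⁻¹ = 1/ d

sum-mono-≤ : ∀ {k} {g h : Fin k → ℚ} → (∀ i → g i ≤ h i) → sum g ≤ sum h
sum-mono-≤ {ℕ.zero}  g≤h = ≤-refl
sum-mono-≤ {ℕ.suc k} g≤h = +-mono-≤ (g≤h zero) (sum-mono-≤ (g≤h ∘ suc))

sum-nonNeg : ∀ {k} {g : Fin k → ℚ} → (∀ i → 0ℚ ≤ g i) → 0ℚ ≤ sum g
sum-nonNeg {k} 0≤g = ≤-trans (≤-reflexive (sym (sum-replicate-zero k))) (sum-mono-≤ 0≤g)

*-distribˡ-sum² : ∀ {m n} c (g : Fin m → Fin n → ℚ) →
  c * sum (λ x → sum (g x)) ≡ sum (λ x → sum (λ y → c * g x y))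
*-distribˡ-sum² c g =
  trans (*-distribˡ-sum c (λ x → sum (g x))) (sum-cong-≗ (λ x → *-distribˡ-sum c (g x)))

module _ {A : Set} where

  ΣL-cong : ∀ (L : List A) {g h : A → ℚ} → (∀ a → g a ≡ h a) → ΣL L g ≡ ΣL L h
  ΣL-cong []      g≗h = refl
  ΣL-cong (a ∷ L) g≗h = cong₂ _+_ (g≗h a) (ΣL-cong L g≗h)

  *-distribˡ-ΣL : ∀ c (L : List A) (g : A → ℚ) → c * ΣL L g ≡ ΣL L (λ a → c * g a)
  *-distribˡ-ΣL c []      g = *-zeroʳ c
  *-distribˡ-ΣL c (a ∷ L) g =
    trans (*-distribˡ-+ c (g a) _) (cong (c * g a +_) (*-distribˡ-ΣL c L g))

  sum-ΣL-comm : ∀ {k} (L : List A) (g : Fin k → A → ℚ) →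
    sum (λ i → ΣL L (g i)) ≡ ΣL L (λ a → sum (λ i → g i a))
  sum-ΣL-comm {k} []      g = sum-replicate-zero k
  sum-ΣL-comm     (a ∷ L) g =
    trans (∑-distrib-+ (λ i → g i a) _) (cong (sum (λ i → g i a) +_) (sum-ΣL-comm L g))

  ΣL-weighted-≤ : ∀ {L : List A} {w u v : A → ℚ} {M c : ℚ} → (∀ a → 0ℚ ≤ w a) →
    All (λ a → u a ≤ M + c * v a) L →
    ΣL L (λ a → w a * u a) ≤ M * ΣL L w + c * ΣL L (λ a → w a * v a)
  ΣL-weighted-≤ {M = M} {c} _ [] =
    ≤-reflexive (solve 2 (λ M c → con 0ℚ := M :* con 0ℚ :+ c :* con 0ℚ) refl M c)
  ΣL-weighted-≤ {a ∷ L} {w} {u} {v} {M} {c} 0≤w (u≤ ∷ us≤) = begin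
    w a * u a + ΣL L (λ a → w a * u a)
      ≤⟨ +-mono-≤ (*-monoˡ-≤-nonNeg (w a) {{nonNegative (0≤w a)}} u≤)
                  (ΣL-weighted-≤ {v = v} {M} {c} 0≤w us≤) ⟩
    w a * (M + c * v a) + (M * ΣL L w + c * ΣL L (λ a → w a * v a))
      ≡⟨ solve 6 (λ wa va M c W V → wa :* (M :+ c :* va) :+ (M :* W :+ c :* V)
                                   := M :* (wa :+ W) :+ c :* (wa :* va :+ V))
               refl (w a) (v a) M c (ΣL L w) (ΣL L (λ a → w a * v a)) ⟩
    M * (w a + ΣL L w) + c * (w a * v a + ΣL L (λ a → w a * v a))
      ∎
    where open ≤-Reasoning

[]ℚ-nonNeg : ∀ b → 0ℚ ≤ [ b ]ℚ
[]ℚ-nonNeg true  = nonNegative⁻¹ 1ℚ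
[]ℚ-nonNeg false = ≤-refl

[∧]ℚ≡[]ℚ*[]ℚ : ∀ a b → [ a ∧ b ]ℚ ≡ [ a ]ℚ * [ b ]ℚ
[∧]ℚ≡[]ℚ*[]ℚ true  b = sym (*-identityˡ [ b ]ℚ)
[∧]ℚ≡[]ℚ*[]ℚ false b = sym (*-zeroˡ [ b ]ℚ)

[∧]ℚ≤[]ℚ : ∀ a b → [ a ∧ b ]ℚ ≤ [ a ]ℚ
[∧]ℚ≤[]ℚ true  true  = ≤-refl
[∧]ℚ≤[]ℚ true  false = nonNegative⁻¹ 1ℚ
[∧]ℚ≤[]ℚ false b     = ≤-refl

[]ℚ*u*c≤δ*[]ℚ*u : ∀ b {u c δ} → 0ℚ ≤ u → (b ≡ true → c ≤ δ) → [ b ]ℚ * u * c ≤ δ * ([ b ]ℚ * u)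
[]ℚ*u*c≤δ*[]ℚ*u true {u} {c} {δ} 0≤u c≤δ = begin
  1ℚ * u * c   ≡⟨ solve 2 (λ u c → con 1ℚ :* u :* c := c :* u) refl u c ⟩
  c * u        ≤⟨ *-monoʳ-≤-nonNeg u {{nonNegative 0≤u}} (c≤δ refl) ⟩
  δ * u        ≡⟨ cong (δ *_) (*-identityˡ u) ⟨
  δ * (1ℚ * u) ∎
  where open ≤-Reasoning
[]ℚ*u*c≤δ*[]ℚ*u false {u} {c} {δ} _ _ =
  ≤-reflexive (solve 3 (λ u c δ → con 0ℚ :* u :* c := δ :* (con 0ℚ :* u)) refl u c δ)

==⇒≡ : ∀ a b → (a == b) ≡ true → a ≡ b
==⇒≡ true  true  _ = refl
==⇒≡ false false _ = refl

module _ {m n : ℕ} (μ : Fin m → Fin n → ℚ) (f : Fin m → Fin n → Bool) where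

  μ₀ μ₁ : Rect m n → ℚ
  μ₀ = μzR μ f false
  μ₁ = μzR μ f true

  ∅R : Rect m n
  ∅R = ⊥ , ⊥

  μzR-∅R : ∀ z → μzR μ f z ∅R ≡ 0ℚ
  μzR-∅R z = trans (sum-cong-≗ λ x → trans (sum-cong-≗ (term x)) (sum-replicate-zero n))
                   (sum-replicate-zero m)
    where
    term : ∀ x y → [ ((x , y) ∈R ∅R) ∧ (f x y == z) ]ℚ * μ x y ≡ 0ℚ
    term x y =
      trans (cong (λ b → [ (b ∧ _) ∧ _ ]ℚ * μ x y) (lookup-replicate x false)) (*-zeroˡ (μ x y))

  ∅R-biased : ∀ α → BiasedTowards0 μ f α ∅R
  ∅R-biased α = ≤-reflexive (begin
    μ₁ ∅R      ≡⟨ μzR-∅R true ⟩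
    0ℚ         ≡⟨ *-zeroʳ α ⟨
    α * 0ℚ     ≡⟨ cong (α *_) (μzR-∅R false) ⟨
    α * μ₀ ∅R  ∎)
    where open ≡-Reasoning

  biased? : ∀ α → Decidable (BiasedTowards0 μ f α)
  biased? α R = μ₁ R ≤? α * μ₀ R

  cover-double-counting : ∀ z (w : Rect m n → ℚ) →
    sum (λ x → sum (λ y → [ f x y == z ]ℚ * μ x y * cover μ f w x y))
      ≡ ΣL (allRects m n) (λ R → w R * μzR μ f z R)
  cover-double-counting z w = begin
    sum (λ x → sum (λ y → g x y * ΣL L (λ R → [ (x , y) ∈R R ]ℚ * w R)))
      ≡⟨ sum-cong-≗ (λ x → sum-cong-≗ (λ y → *-distribˡ-ΣL (g x y) L _)) ⟩
    sum (λ x → sum (λ y → ΣL L (h x y)))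
      ≡⟨ sum-cong-≗ (λ x → sum-ΣL-comm L (h x)) ⟩
    sum (λ x → ΣL L (λ R → sum (λ y → h x y R)))
      ≡⟨ sum-ΣL-comm L (λ x R → sum (λ y → h x y R)) ⟩
    ΣL L (λ R → sum (λ x → sum (λ y → h x y R)))
      ≡⟨ ΣL-cong L (λ R → trans (sum-cong-≗ (λ x → sum-cong-≗ (reorder R x)))
                                (sym (*-distribˡ-sum² (w R) (mass R)))) ⟩
    ΣL L (λ R → w R * μzR μ f z R)
      ∎
    where
    open ≡-Reasoning
    L = allRects m n
    g : Fin m → Fin n → ℚ
    g x y = [ f x y == z ]ℚ * μ x y
    h : Fin m → Fin n → Rect m n → ℚ
    h x y R = g x y * ([ (x , y) ∈R R ]ℚ * w R)
    mass : Rect m n → Fin m → Fin n → ℚ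
    mass R x y = [ ((x , y) ∈R R) ∧ (f x y == z) ]ℚ * μ x y
    reorder : ∀ R x y → h x y R ≡ w R * mass R x y
    reorder R x y = begin
      [ f x y == z ]ℚ * μ x y * ([ (x , y) ∈R R ]ℚ * w R)
        ≡⟨ solve 4 (λ b u a v → b :* u :* (a :* v) := v :* (a :* b :* u))
                 refl [ f x y == z ]ℚ (μ x y) [ (x , y) ∈R R ]ℚ (w R) ⟩
      w R * ([ (x , y) ∈R R ]ℚ * [ f x y == z ]ℚ * μ x y)
        ≡⟨ cong (λ t → w R * (t * μ x y)) ([∧]ℚ≡[]ℚ*[]ℚ ((x , y) ∈R R) (f x y == z)) ⟨
      w R * mass R x y
        ∎

  module _ (μ≥0 : ∀ x y → 0ℚ ≤ μ x y) where

    μzR-nonNeg : ∀ z R → 0ℚ ≤ μzR μ f z R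
    μzR-nonNeg z R = sum-nonNeg λ x → sum-nonNeg λ y →
      *-nonNeg ([]ℚ-nonNeg (((x , y) ∈R R) ∧ (f x y == z))) (μ≥0 x y)

    μzR≤μR : ∀ z R → μzR μ f z R ≤ μR μ f R
    μzR≤μR z R = sum-mono-≤ λ x → sum-mono-≤ λ y →
      *-monoʳ-≤-nonNeg (μ x y) {{nonNegative (μ≥0 x y)}} ([∧]ℚ≤[]ℚ ((x , y) ∈R R) (f x y == z))

    cover-off-target-≤ : ∀ z {w δ} → (∀ x y → f x y ≡ z → cover μ f w x y ≤ δ) →
      ΣL (allRects m n) (λ R → w R * μzR μ f z R) ≤ δ * μz μ f z
    cover-off-target-≤ z {w} {δ} cover≤δ = begin
      ΣL (allRects m n) (λ R → w R * μzR μ f z R)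
        ≡⟨ cover-double-counting z w ⟨
      sum (λ x → sum (λ y → [ f x y == z ]ℚ * μ x y * cover μ f w x y))
        ≤⟨ sum-mono-≤ (λ x → sum-mono-≤ (λ y →
             []ℚ*u*c≤δ*[]ℚ*u (f x y == z) (μ≥0 x y) (cover≤δ x y ∘ ==⇒≡ (f x y) z))) ⟩
      sum (λ x → sum (λ y → δ * ([ f x y == z ]ℚ * μ x y)))
        ≡⟨ *-distribˡ-sum² δ (λ x y → [ f x y == z ]ℚ * μ x y) ⟨
      δ * μz μ f z
        ∎
      where open ≤-Reasoning

    dominating-biased-rectangle : ∀ {ρ} (ρ>0 : 0ℚ < ρ) (L : List (Rect m n)) →
      ∃ λ S → BiasedTowards0 μ f ρ S
            × All (λ R → μ₀ R ≤ μ₀ S + (1/ ρ) {{>-nonZero ρ>0}} * μ₁ R) L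
    dominating-biased-rectangle {ρ} ρ>0 L =
      S , argmax-all μ₀ (∅R-biased ρ) (all-filter (biased? ρ) L) , All.tabulate dominates
      where
      S = argmax μ₀ ∅R (filter (biased? ρ) L)
      ρ⁻¹*μ₁≥0 : ∀ R → 0ℚ ≤ (1/ ρ) {{>-nonZero ρ>0}} * μ₁ R
      ρ⁻¹*μ₁≥0 R = *-nonNeg (1/-nonNeg ρ>0) (μzR-nonNeg true R)
      dominates : ∀ {R} → R ∈ L → μ₀ R ≤ μ₀ S + (1/ ρ) {{>-nonZero ρ>0}} * μ₁ R
      dominates {R} R∈L with biased? ρ R
      ... | yes R-biased = ≤-trans
        (All.lookup (f[xs]≤f[argmax] {f = μ₀} ∅R (filter (biased? ρ) L))
                    (∈-filter⁺ (biased? ρ) R∈L R-biased))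
        (p≤p+q {μ₀ S} (ρ⁻¹*μ₁≥0 R))
      ... | no R-unbiased =
        ≤-trans (ρ*p<q⇒p≤1/ρ*q ρ>0 (≰⇒> R-unbiased)) (p≤q+p (μzR-nonNeg false S))

    SrecFeasible-mass-bound : ∀ {ε δ D c w S} → SrecFeasible μ f false ε δ w →
      ΣL (allRects m n) w ≤ D → 0ℚ ≤ c →
      All (λ R → μ₀ R ≤ μ₀ S + c * μ₁ R) (allRects m n) →
      (1ℚ - ε) * μz μ f false ≤ μ₀ S * D + δ * c * μz μ f true
    SrecFeasible-mass-bound {ε} {δ} {D} {c} {w} {S}
      (w≥0 , covers , off-target , _) ∑w≤D c≥0 S-dominates = begin
      (1ℚ - ε) * μz μ f false
        ≤⟨ covers ⟩
      sum (λ x → sum (λ y → [ f x y == false ]ℚ * μ x y * cover μ f w x y))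
        ≡⟨ cover-double-counting false w ⟩
      ΣL L (λ R → w R * μ₀ R)
        ≤⟨ ΣL-weighted-≤ {u = μ₀} {v = μ₁} {μ₀ S} {c} w≥0 S-dominates ⟩
      μ₀ S * ΣL L w + c * ΣL L (λ R → w R * μ₁ R)
        ≤⟨ +-mono-≤ (*-monoˡ-≤-nonNeg (μ₀ S) {{nonNegative (μzR-nonNeg false S)}} ∑w≤D)
                    (*-monoˡ-≤-nonNeg c {{nonNegative c≥0}} (cover-off-target-≤ true off-target)) ⟩
      μ₀ S * D + c * (δ * μz μ f true)
        ≡⟨ cong (μ₀ S * D +_)
                (solve 3 (λ c δ u → c :* (δ :* u) := δ :* c :* u) refl c δ (μz μ f true)) ⟩
      μ₀ S * D + δ * c * μz μ f true
        ∎
      where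
      open ≤-Reasoning
      L = allRects m n

lemma2p6 : (m n : ℕ) (f : Fin m → Fin n → Bool)
    (μA : Fin m → ℚ) (μB : Fin n → ℚ) → IsDistribution μA → IsDistribution μB →
    (ε δ D : ℚ) (D>0 : 0ℚ < D) →
    SrecLE (prodμ μA μB) f false ε δ D →
    (ρ : ℚ) (ρ>0 : 0ℚ < ρ) → ρ < 1ℚ →
    ∃ λ (S : Rect m n) →
      BiasedTowards0 (prodμ μA μB) f ρ S
      × μzR (prodμ μA μB) f false S ≤ μR (prodμ μA μB) f S
      × (((1/ D) {{>-nonZero D>0}}) * ((1ℚ - ε) * μz (prodμ μA μB) f false
           - ((δ ÷ ρ) {{>-nonZero ρ>0}}) * μz (prodμ μA μB) f true)
         ≤ μzR (prodμ μA μB) f false S)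
lemma2p6 m n f μA μB (μA≥0 , _) (μB≥0 , _) ε δ D D>0 (w , feasible , ∑w≤D) ρ ρ>0 _ =
  let S , S-biased , S-dominates = dominating-biased-rectangle μ f μ≥0 ρ>0 (allRects m n)
  in  S , S-biased , μzR≤μR μ f μ≥0 false S
    , ≤*+⇒1/*-≤ D>0 (SrecFeasible-mass-bound μ f μ≥0 {ε = ε} {S = S}
                        feasible ∑w≤D (1/-nonNeg ρ>0) S-dominates)
  where
  μ = prodμ μA μB
  μ≥0 : ∀ x y → 0ℚ ≤ μ x y
  μ≥0 x y = *-nonNeg (μA≥0 x) (μB≥0 y)
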